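{- Let $n$ and $\alpha$ be positive integers and let $m=(m_1,\ldots,m_v)\in\mathbb{Z}_{\ge 0}^{v}$. Suppose there is a $2$-$(v,k,\lambda)$ design $\mathcal{D}$ with $b$ blocks, each point lying in exactly $r$ blocks, and let $A$ be its $b\times v$ incidence matrix. If each entry of the $b\times 1$ integer matrix $Am^T$ is at least $\alpha$, then for every $i\in\{1,\ldots,v\}$, \[ \frac{r\alpha-\lambda\sum_{j=1}^v m_j}{r-\lambda}\le m_i\le \sum_{j=1}^v m_j-\frac{b-r}{r-\lambda}\alpha . \]
   Context: A $2$-$(v,k,\lambda)$ design is a set of $v$ points with a collection of $k$-element subsets (blocks) such that every 2-element subset of points lies in exactly $\lambda$ blocks; $b$ is the number of blocks and $r$ the number of blocks containing a given point. The incidence matrix $A=(a_{ij})$ has $a_{ij}=1$ if the $j$-th point lies in the $i$-th block and $a_{ij}=0$ otherwise. -}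

module Defs where

open import Data.Nat using (ℕ; zero; suc; _+_; _*_)
open import Data.Bool using (Bool; true; false; if_then_else_; _∧_)
open import Data.Fin using (Fin; zero; suc)
open import Data.Fin.Subset using (Subset; ∣_∣)
open import Data.Vec using (lookup)
open import Relation.Binary.PropositionalEquality using (_≡_; _≢_)

sumFin : {n : ℕ} → (Fin n → ℕ) → ℕ
sumFin {zero}  f = 0
sumFin {suc n} f = f zero + sumFin (λ i → f (suc i))

countFin : {n : ℕ} → (Fin n → Bool) → ℕ
countFin P = sumFin (λ i → if P i then 1 else 0)

-- A design on point set Fin v with b blocks (a family, repeats allowed):
-- block i is the subset B i of Fin v.
-- 2-(v,k,λ) design: every block has k points, every pair of distinct points
-- lies in exactly λ blocks; additionally every point lies in exactly r blocks.
record Is2Design (v k λ' b r : ℕ) (B : Fin b → Subset v) : Set where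
  field
    blockSize   : ∀ i → ∣ B i ∣ ≡ k
    pairCount   : ∀ j j' → j ≢ j' → countFin (λ i → lookup (B i) j ∧ lookup (B i) j') ≡ λ'
    replication : ∀ j → countFin (λ i → lookup (B i) j) ≡ r

incidence : {v b : ℕ} → (Fin b → Subset v) → Fin b → Fin v → ℕ
incidence B i j = if lookup (B i) j then 1 else 0

mulVec : {v b : ℕ} → (Fin b → Fin v → ℕ) → (Fin v → ℕ) → Fin b → ℕ
mulVec A m i = sumFin (λ j → A i j * m j)

-- Fix a point i and let U be the sum of the entries of A m over the r blocks
-- through i. Double counting gives U = λ Σ m + (r − λ) m_i, since i lies in r
-- blocks and every other point meets i in λ of them; each entry is at least
-- α, so r α ≤ U, which is the lower bound. All b entries of A m add up to
-- r Σ m, and the b − r blocks avoiding i contribute at least (b − r) α, so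
-- U + (b − r) α ≤ r Σ m, which is the upper bound.
module Submission where

open import Defs
open import Data.Nat using (ℕ; _<_; _≤_)
open import Data.Fin using (Fin; zero; suc; punchIn)
open import Data.Fin.Subset using (Subset)
open import Data.Integer using (+_; _-_; _*_) renaming (_≤_ to _≤ℤ_)
open import Data.Product using (_×_; _,_)
open import Data.Bool using (Bool; true; false; if_then_else_; _∧_)
open import Data.Fin.Properties using (punchInᵢ≢i)
open import Data.Vec using (lookup)
open import Data.Vec.Functional using (removeAt)
open import Function using (_∘_)
open import Relation.Binary.PropositionalEquality
import Data.Nat as ℕ
import Data.Nat.Properties as ℕ
import Data.Integer as ℤ
import Data.Integer.Properties as ℤ
open import Data.Nat.Tactic.RingSolver using (solve-∀)
import Data.Integer.Tactic.RingSolver as ℤ-Solver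
open import Algebra.Properties.Semiring.Sum ℕ.+-*-semiring
  using (sum; sum-cong-≗; ∑-distrib-+; ∑-comm; sum-remove; *-distribˡ-sum; *-distribʳ-sum)

sumFin≡sum : ∀ {n} (f : Fin n → ℕ) → sumFin f ≡ sum f
sumFin≡sum {ℕ.zero}  f = refl
sumFin≡sum {ℕ.suc n} f = cong (f zero ℕ.+_) (sumFin≡sum (f ∘ suc))

sum-mono-≤ : ∀ {n} {f g : Fin n → ℕ} → (∀ j → f j ≤ g j) → sum f ≤ sum g
sum-mono-≤ {ℕ.zero}  f≤g = ℕ.z≤n
sum-mono-≤ {ℕ.suc n} f≤g = ℕ.+-mono-≤ (f≤g zero) (sum-mono-≤ (f≤g ∘ suc))

sum-const : ∀ n c → sum {n} (λ _ → c) ≡ n ℕ.* c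
sum-const ℕ.zero    c = refl
sum-const (ℕ.suc n) c = cong (c ℕ.+_) (sum-const n c)

sum-weighted-≥ : ∀ {n} (w f : Fin n → ℕ) {α} → (∀ j → α ≤ f j) →
                 sum w ℕ.* α ≤ sum (λ j → w j ℕ.* f j)
sum-weighted-≥ w f {α} α≤f = begin
  sum w ℕ.* α              ≡⟨ *-distribʳ-sum α w ⟩
  sum (λ j → w j ℕ.* α)    ≤⟨ sum-mono-≤ (λ j → ℕ.*-monoʳ-≤ (w j) (α≤f j)) ⟩
  sum (λ j → w j ℕ.* f j)  ∎
  where open ℕ.≤-Reasoning

sum-agreeing-off : ∀ {n} (i : Fin n) (f g : Fin n → ℕ) → (∀ j → j ≢ i → f j ≡ g j) →
                   sum f ℕ.+ g i ≡ sum g ℕ.+ f i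
sum-agreeing-off {ℕ.suc n} i f g f≡g = begin
  sum f ℕ.+ g i                       ≡⟨ cong (ℕ._+ g i) (sum-remove f) ⟩
  f i ℕ.+ sum (removeAt f i) ℕ.+ g i  ≡⟨ cong (λ s → f i ℕ.+ s ℕ.+ g i) rest ⟩
  f i ℕ.+ sum (removeAt g i) ℕ.+ g i  ≡⟨ swap (f i) (sum (removeAt g i)) (g i) ⟩
  g i ℕ.+ sum (removeAt g i) ℕ.+ f i  ≡⟨ cong (ℕ._+ f i) (sum-remove g) ⟨
  sum g ℕ.+ f i                       ∎
  where
  open ≡-Reasoning
  rest : sum (removeAt f i) ≡ sum (removeAt g i)
  rest = sum-cong-≗ (λ j → f≡g (punchIn i j) (punchInᵢ≢i i j))
  swap : ∀ x s y → x ℕ.+ s ℕ.+ y ≡ y ℕ.+ s ℕ.+ x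
  swap = solve-∀

sum-weighted-mulVec : ∀ {b v} (A : Fin b → Fin v → ℕ) (w : Fin b → ℕ) (m : Fin v → ℕ) →
                      sum (λ x → w x ℕ.* mulVec A m x) ≡ sum (λ j → sum (λ x → w x ℕ.* A x j) ℕ.* m j)
sum-weighted-mulVec A w m = begin
  sum (λ x → w x ℕ.* mulVec A m x)
    ≡⟨ sum-cong-≗ (λ x → cong (w x ℕ.*_) (sumFin≡sum (λ j → A x j ℕ.* m j))) ⟩
  sum (λ x → w x ℕ.* sum (λ j → A x j ℕ.* m j))
    ≡⟨ sum-cong-≗ (λ x → *-distribˡ-sum (w x) (λ j → A x j ℕ.* m j)) ⟩
  sum (λ x → sum (λ j → w x ℕ.* (A x j ℕ.* m j)))
    ≡⟨ ∑-comm (λ x j → w x ℕ.* (A x j ℕ.* m j)) ⟩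
  sum (λ j → sum (λ x → w x ℕ.* (A x j ℕ.* m j)))
    ≡⟨ sum-cong-≗ (λ j → sum-cong-≗ (λ x → ℕ.*-assoc (w x) (A x j) (m j))) ⟨
  sum (λ j → sum (λ x → w x ℕ.* A x j ℕ.* m j))
    ≡⟨ sum-cong-≗ (λ j → *-distribʳ-sum (m j) (λ x → w x ℕ.* A x j)) ⟨
  sum (λ j → sum (λ x → w x ℕ.* A x j) ℕ.* m j)
    ∎
  where open ≡-Reasoning

indicator : Bool → ℕ
indicator p = if p then 1 else 0

indicator-∧ : ∀ p q → indicator (p ∧ q) ≡ indicator p ℕ.* indicator q
indicator-∧ true  q = sym (ℕ.+-identityʳ (indicator q))
indicator-∧ false q = refl

indicator-idem : ∀ p → indicator p ℕ.* indicator p ≡ indicator p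
indicator-idem true  = refl
indicator-idem false = refl

indicator-+-complement : ∀ p → indicator p ℕ.+ (1 ℕ.∸ indicator p) ≡ 1
indicator-+-complement true  = refl
indicator-+-complement false = refl

module _ {v k λ' b r} {B : Fin b → Subset v} (D : Is2Design v k λ' b r B) where
  open Is2Design D

  private
    a : Fin b → Fin v → ℕ
    a = incidence B

    avoids : Fin v → Fin b → ℕ
    avoids i x = 1 ℕ.∸ a x i

    a+avoids≡1 : ∀ i x → a x i ℕ.+ avoids i x ≡ 1
    a+avoids≡1 i x = indicator-+-complement (lookup (B x) i)

  sum-column : ∀ j → sum (λ x → a x j) ≡ r
  sum-column j = trans (sym (sumFin≡sum (λ x → a x j))) (replication j)

  sum-avoids : ∀ i → r ℕ.+ sum (avoids i) ≡ b
  sum-avoids i = begin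
    r ℕ.+ sum (avoids i)                   ≡⟨ cong (ℕ._+ sum (avoids i)) (sum-column i) ⟨
    sum (λ x → a x i) ℕ.+ sum (avoids i)   ≡⟨ ∑-distrib-+ (λ x → a x i) (avoids i) ⟨
    sum (λ x → a x i ℕ.+ avoids i x)       ≡⟨ sum-cong-≗ (a+avoids≡1 i) ⟩
    sum {b} (λ _ → 1)                      ≡⟨ sum-const b 1 ⟩
    b ℕ.* 1                                ≡⟨ ℕ.*-identityʳ b ⟩
    b                                      ∎
    where open ≡-Reasoning

  concurrence-refl : ∀ i → sum (λ x → a x i ℕ.* a x i) ≡ r
  concurrence-refl i = trans (sum-cong-≗ (λ x → indicator-idem (lookup (B x) i))) (sum-column i)

  concurrence-≢ : ∀ {i j} → j ≢ i → sum (λ x → a x i ℕ.* a x j) ≡ λ'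
  concurrence-≢ {i} {j} j≢i = begin
    sum (λ x → a x i ℕ.* a x j)      ≡⟨ sum-cong-≗ (λ x → indicator-∧ (lookup (B x) i) (lookup (B x) j)) ⟨
    sum (λ x → indicator (both x))   ≡⟨ sumFin≡sum (λ x → indicator (both x)) ⟨
    countFin both                    ≡⟨ pairCount i j (j≢i ∘ sym) ⟩
    λ'                               ∎
    where
    open ≡-Reasoning
    both : Fin b → Bool
    both x = lookup (B x) i ∧ lookup (B x) j

  sum-mulVec : ∀ m → sum (mulVec a m) ≡ r ℕ.* sum m
  sum-mulVec m = begin
    sum (mulVec a m)                              ≡⟨ sum-cong-≗ (λ x → ℕ.*-identityˡ (mulVec a m x)) ⟨
    sum (λ x → 1 ℕ.* mulVec a m x)                ≡⟨ sum-weighted-mulVec a (λ _ → 1) m ⟩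
    sum (λ j → sum (λ x → 1 ℕ.* a x j) ℕ.* m j)   ≡⟨ sum-cong-≗ (λ j → cong (ℕ._* m j) (column j)) ⟩
    sum (λ j → r ℕ.* m j)                         ≡⟨ *-distribˡ-sum r m ⟨
    r ℕ.* sum m                                   ∎
    where
    open ≡-Reasoning
    column : ∀ j → sum (λ x → 1 ℕ.* a x j) ≡ r
    column j = trans (sum-cong-≗ (λ x → ℕ.*-identityˡ (a x j))) (sum-column j)

  sum-mulVec-through : ∀ m i →
    sum (λ x → a x i ℕ.* mulVec a m x) ℕ.+ λ' ℕ.* m i ≡ λ' ℕ.* sum m ℕ.+ r ℕ.* m i
  sum-mulVec-through m i = begin
    sum (λ x → a x i ℕ.* mulVec a m x) ℕ.+ λ' ℕ.* m i
      ≡⟨ cong (ℕ._+ λ' ℕ.* m i) (sum-weighted-mulVec a (λ x → a x i) m) ⟩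
    sum (λ j → c j ℕ.* m j) ℕ.+ λ' ℕ.* m i
      ≡⟨ sum-agreeing-off i _ _ (λ j j≢i → cong (ℕ._* m j) (concurrence-≢ j≢i)) ⟩
    sum (λ j → λ' ℕ.* m j) ℕ.+ c i ℕ.* m i
      ≡⟨ cong₂ ℕ._+_ (sym (*-distribˡ-sum λ' m)) (cong (ℕ._* m i) (concurrence-refl i)) ⟩
    λ' ℕ.* sum m ℕ.+ r ℕ.* m i
      ∎
    where
    open ≡-Reasoning
    c : Fin v → ℕ
    c j = sum (λ x → a x i ℕ.* a x j)

  sum-mulVec-through+avoiding : ∀ m i →
    sum (λ x → a x i ℕ.* mulVec a m x) ℕ.+ sum (λ x → avoids i x ℕ.* mulVec a m x) ≡ r ℕ.* sum m
  sum-mulVec-through+avoiding m i = begin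
    sum (λ x → a x i ℕ.* Am x) ℕ.+ sum (λ x → avoids i x ℕ.* Am x)
      ≡⟨ ∑-distrib-+ (λ x → a x i ℕ.* Am x) (λ x → avoids i x ℕ.* Am x) ⟨
    sum (λ x → a x i ℕ.* Am x ℕ.+ avoids i x ℕ.* Am x)
      ≡⟨ sum-cong-≗ (λ x → ℕ.*-distribʳ-+ (Am x) (a x i) (avoids i x)) ⟨
    sum (λ x → (a x i ℕ.+ avoids i x) ℕ.* Am x)
      ≡⟨ sum-cong-≗ (λ x → trans (cong (ℕ._* Am x) (a+avoids≡1 i x)) (ℕ.*-identityˡ (Am x))) ⟩
    sum Am
      ≡⟨ sum-mulVec m ⟩
    r ℕ.* sum m
      ∎
    where
    open ≡-Reasoning
    Am : Fin b → ℕ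
    Am = mulVec a m

  module _ {α} (m : Fin v → ℕ) (α≤Am : ∀ x → α ≤ mulVec a m x) (i : Fin v) where
    private
      through avoiding : ℕ
      through  = sum (λ x → a x i ℕ.* mulVec a m x)
      avoiding = sum (λ x → avoids i x ℕ.* mulVec a m x)

      rα≤through : r ℕ.* α ≤ through
      rα≤through = subst (λ s → s ℕ.* α ≤ through) (sum-column i)
                         (sum-weighted-≥ (λ x → a x i) (mulVec a m) α≤Am)

      avoiding-≥ : sum (avoids i) ℕ.* α ≤ avoiding
      avoiding-≥ = sum-weighted-≥ (avoids i) (mulVec a m) α≤Am

    lower-bound : r ℕ.* α ℕ.+ λ' ℕ.* m i ≤ r ℕ.* m i ℕ.+ λ' ℕ.* sum m
    lower-bound = begin
      r ℕ.* α ℕ.+ λ' ℕ.* m i      ≤⟨ ℕ.+-monoˡ-≤ (λ' ℕ.* m i) rα≤through ⟩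
      through ℕ.+ λ' ℕ.* m i      ≡⟨ sum-mulVec-through m i ⟩
      λ' ℕ.* sum m ℕ.+ r ℕ.* m i  ≡⟨ ℕ.+-comm (λ' ℕ.* sum m) (r ℕ.* m i) ⟩
      r ℕ.* m i ℕ.+ λ' ℕ.* sum m  ∎
      where open ℕ.≤-Reasoning

    upper-bound : r ℕ.* m i ℕ.+ (λ' ℕ.* sum m ℕ.+ b ℕ.* α) ≤ r ℕ.* sum m ℕ.+ r ℕ.* α ℕ.+ λ' ℕ.* m i
    upper-bound = begin
      r ℕ.* m i ℕ.+ (λ' ℕ.* sum m ℕ.+ b ℕ.* α)
        ≡⟨ cong (λ n → r ℕ.* m i ℕ.+ (λ' ℕ.* sum m ℕ.+ n ℕ.* α)) (sum-avoids i) ⟨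
      r ℕ.* m i ℕ.+ (λ' ℕ.* sum m ℕ.+ (r ℕ.+ N) ℕ.* α)
        ≡⟨ regroup r (m i) λ' (sum m) N α ⟩
      λ' ℕ.* sum m ℕ.+ r ℕ.* m i ℕ.+ r ℕ.* α ℕ.+ N ℕ.* α
        ≡⟨ cong (λ s → s ℕ.+ r ℕ.* α ℕ.+ N ℕ.* α) (sum-mulVec-through m i) ⟨
      through ℕ.+ λ' ℕ.* m i ℕ.+ r ℕ.* α ℕ.+ N ℕ.* α
        ≤⟨ ℕ.+-monoʳ-≤ (through ℕ.+ λ' ℕ.* m i ℕ.+ r ℕ.* α) avoiding-≥ ⟩
      through ℕ.+ λ' ℕ.* m i ℕ.+ r ℕ.* α ℕ.+ avoiding
        ≡⟨ collect through (λ' ℕ.* m i) (r ℕ.* α) avoiding ⟩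
      through ℕ.+ avoiding ℕ.+ r ℕ.* α ℕ.+ λ' ℕ.* m i
        ≡⟨ cong (λ s → s ℕ.+ r ℕ.* α ℕ.+ λ' ℕ.* m i) (sum-mulVec-through+avoiding m i) ⟩
      r ℕ.* sum m ℕ.+ r ℕ.* α ℕ.+ λ' ℕ.* m i
        ∎
      where
      open ℕ.≤-Reasoning
      N : ℕ
      N = sum (avoids i)
      regroup : ∀ r x l s n α →
        r ℕ.* x ℕ.+ (l ℕ.* s ℕ.+ (r ℕ.+ n) ℕ.* α) ≡ l ℕ.* s ℕ.+ r ℕ.* x ℕ.+ r ℕ.* α ℕ.+ n ℕ.* α
      regroup = solve-∀
      collect : ∀ t u w z → t ℕ.+ u ℕ.+ w ℕ.+ z ≡ t ℕ.+ z ℕ.+ w ℕ.+ u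
      collect = solve-∀

+-≤-+⇒-≤- : ∀ a b c e → a ℕ.+ e ≤ c ℕ.+ b → + a - + b ≤ℤ + c - + e
+-≤-+⇒-≤- a b c e a+e≤c+b = begin
  + a - + b                      ≡⟨ add-both (+ a) (+ b) (+ e) ⟩
  (+ a ℤ.+ + e) - (+ b ℤ.+ + e)  ≡⟨ cong (_- (+ b ℤ.+ + e)) (ℤ.pos-+ a e) ⟨
  + (a ℕ.+ e) - (+ b ℤ.+ + e)    ≤⟨ ℤ.+-monoˡ-≤ (ℤ.- (+ b ℤ.+ + e)) (ℤ.+≤+ a+e≤c+b) ⟩
  + (c ℕ.+ b) - (+ b ℤ.+ + e)    ≡⟨ cong (_- (+ b ℤ.+ + e)) (ℤ.pos-+ c b) ⟩
  (+ c ℤ.+ + b) - (+ b ℤ.+ + e)  ≡⟨ cancel-both (+ c) (+ b) (+ e) ⟩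
  + c - + e                      ∎
  where
  open ℤ.≤-Reasoning
  add-both : ∀ x y z → x - y ≡ (x ℤ.+ z) - (y ℤ.+ z)
  add-both = ℤ-Solver.solve-∀
  cancel-both : ∀ x y z → (x ℤ.+ y) - (y ℤ.+ z) ≡ x - z
  cancel-both = ℤ-Solver.solve-∀

pos-diff-* : ∀ x y z → (+ x - + y) * + z ≡ + (x ℕ.* z) - + (y ℕ.* z)
pos-diff-* x y z = begin
  (+ x - + y) * + z          ≡⟨ distrib (+ x) (+ y) (+ z) ⟩
  + x * + z - + y * + z      ≡⟨ cong₂ _-_ (ℤ.pos-* x z) (ℤ.pos-* y z) ⟨
  + (x ℕ.* z) - + (y ℕ.* z)  ∎
  where
  open ≡-Reasoning
  distrib : ∀ u w t → (u - w) * t ≡ u * t - w * t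
  distrib = ℤ-Solver.solve-∀

lemma3p1 : (n α : ℕ) → 1 ≤ n → 1 ≤ α →
    (v k λ' b r : ℕ) (B : Fin b → Subset v) → Is2Design v k λ' b r B →
    λ' < r →
    (m : Fin v → ℕ) →
    (∀ i → α ≤ mulVec (incidence B) m i) →
    ∀ i →
      ((+ (r Data.Nat.* α)) - (+ (λ' Data.Nat.* sumFin m)) ≤ℤ (+ r - + λ') * (+ m i))
      × ((+ r - + λ') * (+ m i) ≤ℤ (+ r - + λ') * (+ sumFin m) - (+ b - + r) * (+ α))
lemma3p1 _ α _ _ v k λ' b r B D _ m α≤Am i rewrite sumFin≡sum m =
    subst (_ ≤ℤ_) (sym (pos-diff-* r λ' (m i)))
      (+-≤-+⇒-≤- (r ℕ.* α) (λ' ℕ.* S) (r ℕ.* m i) (λ' ℕ.* m i) (lower-bound D m α≤Am i))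
  , subst₂ _≤ℤ_ (sym (pos-diff-* r λ' (m i))) upper-rhs
      (+-≤-+⇒-≤- (r ℕ.* m i) (λ' ℕ.* m i) (r ℕ.* S ℕ.+ r ℕ.* α) (λ' ℕ.* S ℕ.+ b ℕ.* α)
                  (upper-bound D m α≤Am i))
  where
  S : ℕ
  S = sum m
  upper-rhs : + (r ℕ.* S ℕ.+ r ℕ.* α) - + (λ' ℕ.* S ℕ.+ b ℕ.* α) ≡ (+ r - + λ') * + S - (+ b - + r) * + α
  upper-rhs = begin
    + (r ℕ.* S ℕ.+ r ℕ.* α) - + (λ' ℕ.* S ℕ.+ b ℕ.* α)
      ≡⟨ cong₂ _-_ (ℤ.pos-+ (r ℕ.* S) (r ℕ.* α)) (ℤ.pos-+ (λ' ℕ.* S) (b ℕ.* α)) ⟩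
    (+ (r ℕ.* S) ℤ.+ + (r ℕ.* α)) - (+ (λ' ℕ.* S) ℤ.+ + (b ℕ.* α))
      ≡⟨ regroup (+ (r ℕ.* S)) (+ (λ' ℕ.* S)) (+ (b ℕ.* α)) (+ (r ℕ.* α)) ⟩
    (+ (r ℕ.* S) - + (λ' ℕ.* S)) - (+ (b ℕ.* α) - + (r ℕ.* α))
      ≡⟨ cong₂ _-_ (pos-diff-* r λ' S) (pos-diff-* b r α) ⟨
    (+ r - + λ') * + S - (+ b - + r) * + α
      ∎
    where
    open ≡-Reasoning
    regroup : ∀ x y z t → (x ℤ.+ t) - (y ℤ.+ z) ≡ (x - y) - (z - t)
    regroup = ℤ-Solver.solve-∀
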